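{- Let $k,d\in\mathbb{N}$ and let $S=\{x_1,\dots,x_k\}$ be a set of $k$ distinct vertices of a finite graph $G$. If $G-S$ is equitably $(k,\mathcal{D}_{d-1})$-choosable and $|N_G(x_i)\setminus S|\le di-1$ for every $i\in\{1,\dots,k\}$, then $G$ is equitably $(k,\mathcal{D}_{d-1})$-choosable.
   Context: $G-S$ denotes the subgraph of $G$ induced by $V(G)\setminus S$; $N_G(v)$ is the set of neighbours of $v$ in $G$. For $d\in\mathbb{N}_0$, a graph is $d$-degenerate if every subgraph $H$ has minimum degree $\delta(H)\le d$; $\mathcal{D}_d$ denotes the class of $d$-degenerate graphs ($\mathcal{D}_0$ = edgeless graphs). A list assignment $L$ for $G$ assigns a nonempty subset $L(v)\subseteq\mathbb{N}$ to each vertex; it is $k$-uniform if $|L(v)|=k$ for all $v$. An $(L,\mathcal{D}_d)$-colouring is a map $c:V(G)\to\mathbb{N}$ with $c(v)\in L(v)$ such that each colour class induces a $d$-degenerate graph. $G$ is equitably $(k,\mathcal{D}_d)$-choosable if for every $k$-uniform list assignment $L$ there is an $(L,\mathcal{D}_d)$-colouring of $G$ in which every colour class has at most $\lceil |V(G)|/k\rceil$ vertices. -}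

module Defs where

open import Data.Nat using (ℕ; zero; suc; _+_; _*_; _∸_; _≤_; NonZero)
open import Data.Nat.DivMod using (_/_)
open import Data.Bool using (Bool; true; false; _∧_)
open import Data.Fin using (Fin)
open import Data.Fin.Subset using (Subset; _∈_; _⊆_; _∩_; ∣_∣; Nonempty)
open import Data.Vec using (tabulate; lookup)
open import Data.List using (List; length)
open import Data.List.Relation.Unary.Unique.Propositional using (Unique)
import Data.List.Membership.Propositional as LMem
open import Relation.Binary.PropositionalEquality using (_≡_)
open import Data.Product using (∃; _×_)
open import Data.Fin.Properties using (any?)
import Data.Fin as F
open import Relation.Nullary.Decidable using (⌊_⌋)
open import Data.Nat using (_≟_)

record Graph (n : ℕ) : Set where
  field
    adj    : Fin n → Fin n → Bool
    sym    : ∀ u v → adj u v ≡ adj v u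
    irrefl : ∀ v → adj v v ≡ false
open Graph public

N : ∀ {n} → Graph n → Fin n → Subset n
N G v = tabulate (adj G v)

degIn : ∀ {n} → Graph n → Subset n → Fin n → ℕ
degIn G H v = ∣ N G v ∩ H ∣

Degenerate : ∀ {n} → ℕ → Graph n → Subset n → Set
Degenerate d G U = ∀ (H : Subset _) → H ⊆ U → Nonempty H →
  ∃ λ v → v ∈ H × degIn G H v ≤ d

⌈_/_⌉ : ℕ → (k : ℕ) → .{{NonZero k}} → ℕ
⌈ m / k ⌉ = (m + k ∸ 1) / k

-- List assignments: L v is a list of distinct colours (a finite set of colours).
ListAssignment : ℕ → Set
ListAssignment n = Fin n → List ℕ

Uniform : ∀ {n} → ℕ → ListAssignment n → Set
Uniform k L = ∀ v → Unique (L v) × length (L v) ≡ k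

colourClass : ∀ {n} → Subset n → (Fin n → ℕ) → ℕ → Subset n
colourClass W c α = tabulate λ v → lookup W v ∧ ⌊ c v ≟ α ⌋

IsLDColouring : ∀ {n} → ℕ → Graph n → Subset n → ListAssignment n → (Fin n → ℕ) → Set
IsLDColouring d G W L c =
  (∀ v → v ∈ W → c v LMem.∈ L v) ×
  (∀ α → Degenerate d G (colourClass W c α))

EquitablyChoosable : ∀ {n} (k : ℕ) → .{{NonZero k}} → ℕ → Graph n → Subset n → Set
EquitablyChoosable k d G W =
  ∀ (L : ListAssignment _) → Uniform k L →
  ∃ λ (c : Fin _ → ℕ) →
    IsLDColouring d G W L c ×
    (∀ α → ∣ colourClass W c α ∣ ≤ ⌈ ∣ W ∣ / k ⌉)

setOf : ∀ {k n} → (Fin k → Fin n) → Subset n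
setOf x = tabulate λ v → ⌊ any? (λ i → x i F.≟ v) ⌋

-- Colour G - S from the hypothesis, then give the vertices of S pairwise distinct
-- colours from their lists, greedily from x_k down to x_1. When x_i is reached,
-- at least i colours of L(x_i) are still unused, and since the colour classes
-- partition G - S, these i colours together meet at most di - 1 neighbours of
-- x_i; hence one of them, α, meets at most d - 1. Giving x_i the colour α keeps
-- the class of α (d-1)-degenerate, as x_i has degree at most d - 1 in every
-- subgraph of it. Every class gains at most one vertex, and
-- ⌈(|V| - k)/k⌉ + 1 = ⌈|V|/k⌉, so the colouring stays equitable.
module Submission where

open import Defs
open import Data.Nat using (ℕ; suc; _*_; _∸_; _≤_; NonZero)
open import Data.Fin using (Fin; toℕ)
open import Data.Fin.Subset using (Subset; ⊤; ∁; _∩_; ∣_∣)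
open import Function.Definitions using (Injective)
open import Relation.Binary.PropositionalEquality using (_≡_)

open import Data.Nat using (zero; _+_; _<_; _<?_; _≟_; z≤n; s≤s; s≤s⁻¹; >-nonZero⁻¹)
open import Data.Nat.Properties
open import Data.Nat.DivMod using (_/_; m/n≡1+[m∸n]/n; /-monoˡ-≤)
open import Data.Nat.ListAction using (sum)
open import Data.Bool using (Bool; true; false; T)
open import Data.Bool.Properties using (T-≡; T-∧)
open import Data.Fin as Fin using (fromℕ; inject₁)
open import Data.Fin.Properties using (any?; toℕ-fromℕ; toℕ-inject₁)
import Data.Fin.Properties as Finₚ
open import Data.Fin.Relation.Unary.Top using (view; ‵fromℕ; ‵inject₁)
open import Data.Fin.Subset using (_∈_; _∉_; _⊆_; _-_; ⁅_⁆)
open import Data.Fin.Subset.Properties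
  using (_∈?_; x∈⁅x⁆; x∈∁p⇒x∉p; x∉p⇒x∈∁p; x∈p∩q⁺; x∈p∩q⁻; x∈p∧x≢y⇒x∈p-y;
         p⊆q⇒∣p∣≤∣q∣; ∣p∩q∣≤∣q∣; ∣⁅x⁆∣≡1; x∈p⇒∣p-x∣<∣p∣; ∣∁p∣≡n∸∣p∣; ∣p∣≤n; ∣⊤∣≡n)
open import Data.Vec using ([]; _∷_; tabulate; lookup)
open import Data.Vec.Properties using (lookup∘tabulate; []=⇒lookup; lookup⇒[]=)
open import Data.List using (List; []; _∷_; length; map; filter)
open import Data.List.Properties using (filter-all; filter-accept; filter-reject)
open import Data.List.Relation.Unary.All as All using (All)
open import Data.List.Relation.Unary.Any using (Any; here; there)
open import Data.List.Relation.Unary.AllPairs using (_∷_)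
open import Data.List.Relation.Unary.Unique.Propositional using (Unique)
open import Data.List.Relation.Unary.Unique.Propositional.Properties using (filter⁺)
open import Data.List.Membership.Propositional using (find) renaming (_∈_ to _∈ₗ_)
open import Data.List.Membership.Propositional.Properties using (∈-filter⁻)
open import Data.Product using (∃; _×_; _,_; proj₁; proj₂)
open import Data.Sum using (_⊎_; inj₁; inj₂)
open import Function using (_∘_)
open import Function.Bundles using (Equivalence)
open import Relation.Nullary using (yes; no; ¬?; contradiction)
open import Relation.Nullary.Decidable using (toWitness; fromWitness)
open import Relation.Binary.PropositionalEquality using (_≢_; refl; trans; cong; subst; module ≡-Reasoning)
  renaming (sym to ≡-sym)

open Equivalence using (to; from)

⌈m+k/k⌉≡1+⌈m/k⌉ : ∀ m k .{{_ : NonZero k}} → ⌈ m + k / k ⌉ ≡ suc ⌈ m / k ⌉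
⌈m+k/k⌉≡1+⌈m/k⌉ m k = begin
  (m + k + k ∸ 1) / k       ≡⟨ cong (_/ k) (+-∸-comm k 1≤m+k) ⟩
  (m + k ∸ 1 + k) / k       ≡⟨ m/n≡1+[m∸n]/n (m≤n+m k (m + k ∸ 1)) ⟩
  suc ((m + k ∸ 1 + k ∸ k) / k) ≡⟨ cong (λ a → suc (a / k)) (m+n∸n≡m (m + k ∸ 1) k) ⟩
  suc ((m + k ∸ 1) / k)     ∎
  where
  open ≡-Reasoning
  1≤m+k : 1 ≤ m + k
  1≤m+k = ≤-trans (>-nonZero⁻¹ k) (m≤n+m k m)

⌈/⌉-monoˡ-≤ : ∀ {m n} k .{{_ : NonZero k}} → m ≤ n → ⌈ m / k ⌉ ≤ ⌈ n / k ⌉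
⌈/⌉-monoˡ-≤ k m≤n = /-monoˡ-≤ k (∸-monoˡ-≤ 1 (+-monoˡ-≤ k m≤n))

sum<d*length⇒any< : ∀ d (g : ℕ → ℕ) as → sum (map g as) < d * length as → Any (λ α → g α < d) as
sum<d*length⇒any< d g [] s<0 = contradiction (≤-trans s<0 (≤-reflexive (*-zeroʳ d))) n≮0
sum<d*length⇒any< d g (a ∷ as) s< with g a <? d
... | yes ga<d = here ga<d
... | no ga≮d = there (sum<d*length⇒any< d g as (+-cancelˡ-< d _ _ (begin-strict
  d + sum (map g as)   ≤⟨ +-monoˡ-≤ _ (≮⇒≥ ga≮d) ⟩
  g a + sum (map g as) <⟨ s< ⟩
  d * suc (length as)  ≡⟨ *-suc d (length as) ⟩
  d + d * length as    ∎)))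
  where open ≤-Reasoning

∈-tabulate⁻ : ∀ {n} {f : Fin n → Bool} {v} → v ∈ tabulate f → T (f v)
∈-tabulate⁻ {f = f} {v} v∈ = from T-≡ (trans (≡-sym (lookup∘tabulate f v)) ([]=⇒lookup v∈))

∈-tabulate⁺ : ∀ {n} {f : Fin n → Bool} {v} → T (f v) → v ∈ tabulate f
∈-tabulate⁺ {f = f} {v} fv = lookup⇒[]= v (tabulate f) (trans (lookup∘tabulate f v) (to T-≡ fv))

∣p∩q∣+∣p∩∁q∣≡∣p∣ : ∀ {n} (p q : Subset n) → ∣ p ∩ q ∣ + ∣ p ∩ ∁ q ∣ ≡ ∣ p ∣
∣p∩q∣+∣p∩∁q∣≡∣p∣ []          []          = refl
∣p∩q∣+∣p∩∁q∣≡∣p∣ (true ∷ p)  (true ∷ q)  = cong suc (∣p∩q∣+∣p∩∁q∣≡∣p∣ p q)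
∣p∩q∣+∣p∩∁q∣≡∣p∣ (true ∷ p)  (false ∷ q) = trans (+-suc _ _) (cong suc (∣p∩q∣+∣p∩∁q∣≡∣p∣ p q))
∣p∩q∣+∣p∩∁q∣≡∣p∣ (false ∷ p) (_ ∷ q)     = ∣p∩q∣+∣p∩∁q∣≡∣p∣ p q

∣p∣≤1+∣p∩∁⁅x⁆∣ : ∀ {n} (p : Subset n) x → ∣ p ∣ ≤ suc ∣ p ∩ ∁ ⁅ x ⁆ ∣
∣p∣≤1+∣p∩∁⁅x⁆∣ p x = begin
  ∣ p ∣                               ≡⟨ ≡-sym (∣p∩q∣+∣p∩∁q∣≡∣p∣ p ⁅ x ⁆) ⟩
  ∣ p ∩ ⁅ x ⁆ ∣ + ∣ p ∩ ∁ ⁅ x ⁆ ∣   ≤⟨ +-monoˡ-≤ _ (∣p∩q∣≤∣q∣ p ⁅ x ⁆) ⟩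
  ∣ ⁅ x ⁆ ∣ + ∣ p ∩ ∁ ⁅ x ⁆ ∣       ≡⟨ cong (_+ ∣ p ∩ ∁ ⁅ x ⁆ ∣) (∣⁅x⁆∣≡1 x) ⟩
  suc ∣ p ∩ ∁ ⁅ x ⁆ ∣                 ∎
  where open ≤-Reasoning

x∈p∩∁⁅y⁆⇒x≢y : ∀ {n} {p : Subset n} {x y} → x ∈ p ∩ ∁ ⁅ y ⁆ → x ≢ y
x∈p∩∁⁅y⁆⇒x≢y {p = p} {x} x∈ refl = x∈∁p⇒x∉p (proj₂ (x∈p∩q⁻ p _ x∈)) (x∈⁅x⁆ x)

module _ {n} (C : ℕ → Subset n) (disjoint : ∀ {v α β} → v ∈ C α → v ∈ C β → α ≡ β) where

  sum-∣∩∣-disjoint≤ : ∀ {as} → Unique as → (p : Subset n) → sum (map (λ α → ∣ p ∩ C α ∣) as) ≤ ∣ p ∣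
  sum-∣∩∣-disjoint≤ {[]}     _          p = z≤n
  sum-∣∩∣-disjoint≤ {a ∷ as} (a∉ ∷ as!) p = begin
    ∣ p ∩ C a ∣ + sum (map (λ α → ∣ p ∩ C α ∣) as)              ≤⟨ +-monoʳ-≤ _ (sum-mono as a∉) ⟩
    ∣ p ∩ C a ∣ + sum (map (λ α → ∣ (p ∩ ∁ (C a)) ∩ C α ∣) as)  ≤⟨ +-monoʳ-≤ _ (sum-∣∩∣-disjoint≤ as! (p ∩ ∁ (C a))) ⟩
    ∣ p ∩ C a ∣ + ∣ p ∩ ∁ (C a) ∣                               ≡⟨ ∣p∩q∣+∣p∩∁q∣≡∣p∣ p (C a) ⟩
    ∣ p ∣                                                       ∎
    where
    open ≤-Reasoning
    outside-C-a : ∀ {β} → a ≢ β → p ∩ C β ⊆ (p ∩ ∁ (C a)) ∩ C β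
    outside-C-a a≢β v∈ with x∈p∩q⁻ p _ v∈
    ... | v∈p , v∈Cβ = x∈p∩q⁺ (x∈p∩q⁺ (v∈p , x∉p⇒x∈∁p (λ v∈Ca → a≢β (disjoint v∈Ca v∈Cβ))) , v∈Cβ)
    sum-mono : ∀ bs → All (a ≢_) bs →
      sum (map (λ α → ∣ p ∩ C α ∣) bs) ≤ sum (map (λ α → ∣ (p ∩ ∁ (C a)) ∩ C α ∣) bs)
    sum-mono []       _            = z≤n
    sum-mono (b ∷ bs) (a≢b All.∷ ≢s) = +-mono-≤ (p⊆q⇒∣p∣≤∣q∣ (outside-C-a a≢b)) (sum-mono bs ≢s)

module _ {k n} {x : Fin k → Fin n} where

  ∈-setOf⁻ : ∀ {v} → v ∈ setOf x → ∃ λ i → x i ≡ v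
  ∈-setOf⁻ v∈ = toWitness (∈-tabulate⁻ v∈)

  ∈-setOf⁺ : ∀ i → x i ∈ setOf x
  ∈-setOf⁺ i = ∈-tabulate⁺ (fromWitness (i , refl))

∣setOf∣≥ : ∀ {n} k (x : Fin k → Fin n) → Injective _≡_ _≡_ x → k ≤ ∣ setOf x ∣
∣setOf∣≥ zero    x x-inj = z≤n
∣setOf∣≥ (suc k) x x-inj = begin-strict
  k                              ≤⟨ ∣setOf∣≥ k (x ∘ Fin.suc) (Finₚ.suc-injective ∘ x-inj) ⟩
  ∣ setOf (x ∘ Fin.suc) ∣        ≤⟨ p⊆q⇒∣p∣≤∣q∣ tail⊆ ⟩
  ∣ setOf x - x Fin.zero ∣       <⟨ x∈p⇒∣p-x∣<∣p∣ (∈-setOf⁺ {x = x} Fin.zero) ⟩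
  ∣ setOf x ∣                    ∎
  where
  open ≤-Reasoning
  tail⊆ : setOf (x ∘ Fin.suc) ⊆ setOf x - x Fin.zero
  tail⊆ v∈ with ∈-setOf⁻ v∈
  ... | i , refl = x∈p∧x≢y⇒x∈p-y (∈-setOf⁺ (Fin.suc i)) (λ eq → suc≢zero (x-inj eq))
    where
    suc≢zero : ∀ {i : Fin k} → Fin.suc i ≢ Fin.zero
    suc≢zero ()

∣∁setOf∣+k≤n : ∀ {n} k (x : Fin k → Fin n) → Injective _≡_ _≡_ x → ∣ ∁ (setOf x) ∣ + k ≤ n
∣∁setOf∣+k≤n {n} k x x-inj = begin
  ∣ ∁ (setOf x) ∣ + k          ≡⟨ cong (_+ k) (∣∁p∣≡n∸∣p∣ (setOf x)) ⟩
  n ∸ ∣ setOf x ∣ + k          ≤⟨ +-monoʳ-≤ _ (∣setOf∣≥ k x x-inj) ⟩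
  n ∸ ∣ setOf x ∣ + ∣ setOf x ∣ ≡⟨ m∸n+n≡m (∣p∣≤n (setOf x)) ⟩
  n                            ∎
  where open ≤-Reasoning

module _ {n} (W : Subset n) (c : Fin n → ℕ) where

  ∈-colourClass⁻ : ∀ {α v} → v ∈ colourClass W c α → v ∈ W × c v ≡ α
  ∈-colourClass⁻ {α} {v} v∈ with to T-∧ (∈-tabulate⁻ v∈)
  ... | v∈W , cv≡α = lookup⇒[]= v W (to T-≡ v∈W) , toWitness cv≡α

  ∈-colourClass⁺ : ∀ {α v} → v ∈ W → c v ≡ α → v ∈ colourClass W c α
  ∈-colourClass⁺ {α} {v} v∈W cv≡α = ∈-tabulate⁺ (from T-∧ (from T-≡ ([]=⇒lookup v∈W) , fromWitness cv≡α))

colourClass-disjoint : ∀ {n} {W : Subset n} {c v α β} → v ∈ colourClass W c α → v ∈ colourClass W c β → α ≡ β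
colourClass-disjoint {W = W} {c} v∈α v∈β =
  trans (≡-sym (proj₂ (∈-colourClass⁻ W c v∈α))) (proj₂ (∈-colourClass⁻ W c v∈β))

v∉N[v] : ∀ {n} (G : Graph n) v → v ∉ N G v
v∉N[v] G v v∈ = subst T (irrefl G v) (∈-tabulate⁻ v∈)

_without_ : List ℕ → ℕ → List ℕ
as without α = filter (λ β → ¬? (β ≟ α)) as

length-without : ∀ α {as} → Unique as → length as ≤ suc (length (as without α))
length-without α {[]}     _           = z≤n
length-without α {b ∷ as} (b∉ ∷ as!) with b ≟ α
... | yes refl = s≤s (≤-reflexive (cong length (≡-sym (begin
  (b ∷ as) without b ≡⟨ filter-reject ≢b? (λ b≢b → b≢b refl) ⟩
  as without b       ≡⟨ filter-all ≢b? (All.map (λ b≢β β≡b → b≢β (≡-sym β≡b)) b∉) ⟩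
  as                 ∎))))
  where
  open ≡-Reasoning
  ≢b? = λ β → ¬? (β ≟ b)
... | no b≢α = begin
  suc (length as)                      ≤⟨ s≤s (length-without α as!) ⟩
  suc (suc (length (as without α)))    ≡⟨ cong (suc ∘ length) (filter-accept (λ β → ¬? (β ≟ α)) {xs = as} b≢α) ⟨
  suc (length ((b ∷ as) without α))    ∎
  where open ≤-Reasoning

distinct-choice : ∀ r (M : Fin r → List ℕ) (P : Fin r → ℕ → Set) →
  (∀ i → Unique (M i)) → (∀ i → r ≤ length (M i)) →
  (∀ i {as} → Unique as → suc (toℕ i) ≤ length as → Any (P i) as) →
  ∃ λ f → Injective _≡_ _≡_ f × (∀ i → f i ∈ₗ M i × P i (f i))
distinct-choice zero    _ _ _ _     _     = (λ ()) , (λ { {()} }) , λ ()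
distinct-choice (suc r) M P M! r≤∣M∣ any-P = f , f-inj , f-spec
  where
  top : Fin (suc r)
  top = fromℕ r
  choice : ∃ λ α → α ∈ₗ M top × P top α
  choice = find (any-P top (M! top) (subst (_≤ length (M top)) (cong suc (≡-sym (toℕ-fromℕ r))) (r≤∣M∣ top)))
  α : ℕ
  α = proj₁ choice
  rest : ∃ λ f′ → Injective _≡_ _≡_ f′ × (∀ j → f′ j ∈ₗ M (inject₁ j) without α × P (inject₁ j) (f′ j))
  rest = distinct-choice r
    (λ j → M (inject₁ j) without α) (P ∘ inject₁)
    (λ j → filter⁺ _ (M! (inject₁ j)))
    (λ j → s≤s⁻¹ (≤-trans (r≤∣M∣ (inject₁ j)) (length-without α (M! (inject₁ j)))))
    (λ j as! i≤ → any-P (inject₁ j) as! (subst (λ t → suc t ≤ _) (≡-sym (toℕ-inject₁ j)) i≤))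
  f′ : Fin r → ℕ
  f′ = proj₁ rest
  f′≢α : ∀ j → f′ j ≢ α
  f′≢α j = proj₂ (∈-filter⁻ (λ β → ¬? (β ≟ α)) {xs = M (inject₁ j)} (proj₁ (proj₂ (proj₂ rest) j)))

  f : Fin (suc r) → ℕ
  f i with view i
  ... | ‵fromℕ     = α
  ... | ‵inject₁ j = f′ j

  f-inj : Injective _≡_ _≡_ f
  f-inj {i} {j} eq with view i | view j
  ... | ‵fromℕ     | ‵fromℕ     = refl
  ... | ‵fromℕ     | ‵inject₁ j′ = contradiction (≡-sym eq) (f′≢α j′)
  ... | ‵inject₁ i′ | ‵fromℕ     = contradiction eq (f′≢α i′)
  ... | ‵inject₁ i′ | ‵inject₁ j′ = cong inject₁ (proj₁ (proj₂ rest) eq)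

  f-spec : ∀ i → f i ∈ₗ M i × P i (f i)
  f-spec i with view i
  ... | ‵fromℕ     = proj₂ choice
  ... | ‵inject₁ j with proj₂ (proj₂ rest) j
  ...   | f′j∈ , Pf′j = proj₁ (∈-filter⁻ _ f′j∈) , Pf′j

some-class-meets-few : ∀ {n} (W : Subset n) (c : Fin n → ℕ) (p : Subset n) {d m} → ∣ p ∣ < d * m →
  ∀ {as} → Unique as → m ≤ length as → Any (λ α → ∣ p ∩ colourClass W c α ∣ < d) as
some-class-meets-few W c p {d} {m} ∣p∣<dm {as} as! m≤∣as∣ = sum<d*length⇒any< d _ as (begin-strict
  sum (map (λ α → ∣ p ∩ colourClass W c α ∣) as) ≤⟨ sum-∣∩∣-disjoint≤ (colourClass W c) (colourClass-disjoint {W = W}) as! p ⟩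
  ∣ p ∣                                          <⟨ ∣p∣<dm ⟩
  d * m                                          ≤⟨ *-monoʳ-≤ d m≤∣as∣ ⟩
  d * length as                                  ∎)
  where open ≤-Reasoning

module Extension {k n} (G : Graph n) (x : Fin k → Fin n) (x-inj : Injective _≡_ _≡_ x)
                 (c₀ : Fin n → ℕ) (f : Fin k → ℕ) (f-inj : Injective _≡_ _≡_ f) where

  S W : Subset n
  S = setOf x
  W = ∁ S

  C₀ : ℕ → Subset n
  C₀ = colourClass W c₀

  c : Fin n → ℕ
  c v with any? (λ i → x i Fin.≟ v)
  ... | yes (i , _) = f i
  ... | no _        = c₀ v

  C : ℕ → Subset n
  C = colourClass ⊤ c

  c-on-S : ∀ i → c (x i) ≡ f i
  c-on-S i with any? (λ j → x j Fin.≟ x i)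
  ... | yes (j , xj≡xi) = cong f (x-inj xj≡xi)
  ... | no ∄j           = contradiction (i , refl) ∄j

  c-on-W : ∀ {v} → v ∉ S → c v ≡ c₀ v
  c-on-W {v} v∉S with any? (λ j → x j Fin.≟ v)
  ... | yes (j , refl) = contradiction (∈-setOf⁺ j) v∉S
  ... | no _           = refl

  ∈C⁻ : ∀ {α v} → v ∈ C α → v ∈ C₀ α ⊎ ∃ λ i → x i ≡ v × f i ≡ α
  ∈C⁻ {α} {v} v∈Cα with v ∈? S
  ... | no v∉S  = inj₁ (∈-colourClass⁺ W c₀ (x∉p⇒x∈∁p v∉S) (trans (≡-sym (c-on-W v∉S)) cv≡α))
    where cv≡α = proj₂ (∈-colourClass⁻ ⊤ c v∈Cα)
  ... | yes v∈S with ∈-setOf⁻ v∈S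
  ...   | i , refl = inj₂ (i , refl , trans (≡-sym (c-on-S i)) (proj₂ (∈-colourClass⁻ ⊤ c v∈Cα)))

  ∣C∣≤1+∣C₀∣ : ∀ α → ∣ C α ∣ ≤ suc ∣ C₀ α ∣
  ∣C∣≤1+∣C₀∣ α with any? (λ i → f i ≟ α)
  ... | yes (i , fi≡α) = ≤-trans (∣p∣≤1+∣p∩∁⁅x⁆∣ (C α) (x i)) (s≤s (p⊆q⇒∣p∣≤∣q∣ C-xi⊆C₀))
    where
    C-xi⊆C₀ : C α ∩ ∁ ⁅ x i ⁆ ⊆ C₀ α
    C-xi⊆C₀ {v} v∈ with ∈C⁻ (proj₁ (x∈p∩q⁻ (C α) _ v∈))
    ... | inj₁ v∈C₀α             = v∈C₀α
    ... | inj₂ (j , refl , fj≡α) = contradiction (cong x (f-inj (trans fj≡α (≡-sym fi≡α)))) (x∈p∩∁⁅y⁆⇒x≢y v∈)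
  ... | no ∄i = ≤-trans (p⊆q⇒∣p∣≤∣q∣ C⊆C₀) (n≤1+n _)
    where
    C⊆C₀ : C α ⊆ C₀ α
    C⊆C₀ v∈ with ∈C⁻ v∈
    ... | inj₁ v∈C₀α          = v∈C₀α
    ... | inj₂ (j , _ , fj≡α) = contradiction (j , fj≡α) ∄i

  -- x_i has no neighbour in S of its own colour, as f is injective and G is loopless.
  c-degenerate : ∀ {d} → (∀ α → Degenerate d G (C₀ α)) →
    (∀ i → ∣ (N G (x i) ∩ W) ∩ C₀ (f i) ∣ ≤ d) → ∀ α → Degenerate d G (C α)
  c-degenerate C₀-degenerate few-neighbours α H H⊆Cα H≢∅ with any? (λ i → x i ∈? H)
  ... | yes (i , xi∈H) =
    x i , xi∈H , ≤-trans (p⊆q⇒∣p∣≤∣q∣ N∩H⊆) (subst (λ β → ∣ (N G (x i) ∩ W) ∩ C₀ β ∣ ≤ _) fi≡α (few-neighbours i))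
    where
    fi≡α : f i ≡ α
    fi≡α = trans (≡-sym (c-on-S i)) (proj₂ (∈-colourClass⁻ ⊤ c (H⊆Cα xi∈H)))
    N∩H⊆ : N G (x i) ∩ H ⊆ (N G (x i) ∩ W) ∩ C₀ α
    N∩H⊆ v∈ with x∈p∩q⁻ (N G (x i)) H v∈
    ... | v∈N , v∈H with ∈C⁻ (H⊆Cα v∈H)
    ...   | inj₁ v∈C₀α = x∈p∩q⁺ (x∈p∩q⁺ (v∈N , proj₁ (∈-colourClass⁻ W c₀ v∈C₀α)) , v∈C₀α)
    ...   | inj₂ (j , refl , fj≡α) with f-inj (trans fj≡α (≡-sym fi≡α))
    ...     | refl = contradiction v∈N (v∉N[v] G (x i))
  ... | no ∄i = C₀-degenerate α H H⊆C₀α H≢∅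
    where
    H⊆C₀α : H ⊆ C₀ α
    H⊆C₀α v∈H with ∈C⁻ (H⊆Cα v∈H)
    ... | inj₁ v∈C₀α          = v∈C₀α
    ... | inj₂ (j , refl , _) = contradiction (j , v∈H) ∄i

  c-isLDColouring : ∀ {d L} → IsLDColouring d G W L c₀ → (∀ i → f i ∈ₗ L (x i)) →
    (∀ i → ∣ (N G (x i) ∩ W) ∩ C₀ (f i) ∣ ≤ d) → IsLDColouring d G ⊤ L c
  c-isLDColouring {L = L} (c₀∈L , C₀-degenerate) f∈L few-neighbours =
    c∈L , c-degenerate C₀-degenerate few-neighbours
    where
    c∈L : ∀ v → v ∈ ⊤ → c v ∈ₗ L v
    c∈L v _ with v ∈? S
    ... | no v∉S  = subst (_∈ₗ L v) (≡-sym (c-on-W v∉S)) (c₀∈L v (x∉p⇒x∈∁p v∉S))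
    ... | yes v∈S with ∈-setOf⁻ v∈S
    ...   | i , refl = subst (_∈ₗ L (x i)) (≡-sym (c-on-S i)) (f∈L i)

proposition1 : (k d : ℕ) → .{{_ : NonZero k}} → .{{_ : NonZero d}} →
    (n : ℕ) (G : Graph n) (x : Fin k → Fin n) → Injective _≡_ _≡_ x →
    EquitablyChoosable k (d ∸ 1) G (∁ (setOf x)) →
    (∀ (i : Fin k) → ∣ N G (x i) ∩ ∁ (setOf x) ∣ ≤ d * suc (toℕ i) ∸ 1) →
    EquitablyChoosable k (d ∸ 1) G ⊤
proposition1 zero    _    {{k≢0}}         = contradiction (>-nonZero⁻¹ 0 {{k≢0}}) n≮0
proposition1 (suc _) zero {{_}}   {{d≢0}} = contradiction (>-nonZero⁻¹ 0 {{d≢0}}) n≮0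
proposition1 (suc k) (suc d) n G x x-inj G-S-choosable degree L L-uniform
  with c₀ , c₀-colouring , c₀-equitable ← G-S-choosable L L-uniform
  with f , f-inj , f-spec ← distinct-choice (suc k) (L ∘ x)
         (λ i α → ∣ (N G (x i) ∩ ∁ (setOf x)) ∩ colourClass (∁ (setOf x)) c₀ α ∣ < suc d)
         (proj₁ ∘ L-uniform ∘ x) (λ i → ≤-reflexive (≡-sym (proj₂ (L-uniform (x i)))))
         (λ i → some-class-meets-few (∁ (setOf x)) c₀ (N G (x i) ∩ ∁ (setOf x)) (s≤s (degree i)))
  = c , c-isLDColouring c₀-colouring (proj₁ ∘ f-spec) (s≤s⁻¹ ∘ proj₂ ∘ f-spec) , c-equitable
  where
  open Extension G x x-inj c₀ f f-inj

  c-equitable : ∀ α → ∣ C α ∣ ≤ ⌈ ∣ ⊤ {n} ∣ / suc k ⌉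
  c-equitable α = begin
    ∣ C α ∣                       ≤⟨ ∣C∣≤1+∣C₀∣ α ⟩
    suc ∣ C₀ α ∣                  ≤⟨ s≤s (c₀-equitable α) ⟩
    suc ⌈ ∣ W ∣ / suc k ⌉         ≡⟨ ⌈m+k/k⌉≡1+⌈m/k⌉ ∣ W ∣ (suc k) ⟨
    ⌈ ∣ W ∣ + suc k / suc k ⌉     ≤⟨ ⌈/⌉-monoˡ-≤ (suc k) (∣∁setOf∣+k≤n (suc k) x x-inj) ⟩
    ⌈ n / suc k ⌉                 ≡⟨ cong ⌈_/ suc k ⌉ (∣⊤∣≡n n) ⟨
    ⌈ ∣ ⊤ {n} ∣ / suc k ⌉         ∎
    where open ≤-Reasoning
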